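{- Fix $M>0$ and $n\ge1$, and let $$\mathcal{A}=\{p/q\in\mathcal{K}: p/q \text{ in lowest terms},\ 3^{n-1}<q\le 3^n,\ \mathcal{P}(p/q)\le M+\log_2 n\}.$$ Then $\#\mathcal{A}\le 2^{M+2}\cdot n\cdot 2^n$.
   Context: $\mathcal{K}$ is the triadic Cantor set; every point of $\mathcal{K}$ has a unique 3-adic expansion with digits in $\{0,2\}$. For a rational $p/q\in\mathcal{K}$ with digit sequence $(\epsilon_i)$, let $\ell\ge0$ be the smallest integer such that $(\epsilon_i)_{i>\ell}$ is purely periodic; the period $\mathcal{P}(p/q)$ is the smallest period of $(\epsilon_i)_{i>\ell}$. -}

module Defs where

open import Data.Nat using (ℕ; zero; suc; _+_; _*_; _^_; _≤_; _<_)
open import Data.Nat.Coprimality using (Coprime)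
open import Data.Product using (Σ; ∃; _×_)
open import Data.Sum using (_⊎_)
open import Relation.Nullary using (¬_)
open import Relation.Binary.PropositionalEquality using (_≡_)

-- A ternary digit sequence: ε i is the digit ε_{i+1} (0-based indexing).
-- Cantor digits: every digit is 0 or 2.
CantorDigits : (ℕ → ℕ) → Set
CantorDigits ε = ∀ i → (ε i ≡ 0) ⊎ (ε i ≡ 2)

-- partial k ε = Σ_{i=1}^{k} ε_i 3^{k-i}   (integer numerator of the k-th partial sum)
partial : (ℕ → ℕ) → ℕ → ℕ
partial ε zero = 0
partial ε (suc k) = 3 * partial ε k + ε k

-- Σ_{i≥1} ε_i 3^{-i} = p/q, for a digit sequence with digits in {0,2}.
-- Equivalent (for such sequences) to: for every k,
--   partial_k / 3^k ≤ p/q ≤ partial_k / 3^k + 3^{-k}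
-- (the tail after k digits lies in [0, 3^{-k}]), cleared of denominators.
Expansion : ℕ → ℕ → (ℕ → ℕ) → Set
Expansion p q ε = ∀ k → (partial ε k * q ≤ p * 3 ^ k) × (p * 3 ^ k ≤ (partial ε k + 1) * q)

CantorExpansion : ℕ → ℕ → (ℕ → ℕ) → Set
CantorExpansion p q ε = CantorDigits ε × Expansion p q ε

PurelyPeriodicFrom : (ℕ → ℕ) → ℕ → ℕ → Set
PurelyPeriodicFrom ε ℓ P = 1 ≤ P × (∀ i → ε (ℓ + P + i) ≡ ε (ℓ + i))

TailPeriodic : (ℕ → ℕ) → ℕ → Set
TailPeriodic ε ℓ = ∃ λ P → PurelyPeriodicFrom ε ℓ P

IsPreperiod : (ℕ → ℕ) → ℕ → Set
IsPreperiod ε ℓ = TailPeriodic ε ℓ × (∀ ℓ' → ℓ' < ℓ → ¬ TailPeriodic ε ℓ')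

IsPeriod : (ℕ → ℕ) → ℕ → Set
IsPeriod ε P = ∃ λ ℓ → IsPreperiod ε ℓ × PurelyPeriodicFrom ε ℓ P
                 × (∀ P' → P' < P → ¬ PurelyPeriodicFrom ε ℓ P')

-- Membership in 𝒜 for parameters 2^M = a/b and n, of the pair (p,q) representing p/q:
-- p/q ∈ 𝒦, lowest terms, 3^(n-1) < q ≤ 3^n, and 𝒫(p/q) ≤ M + log₂ n,
-- the last written as b·2^𝒫 ≤ a·n  (i.e. 2^𝒫 ≤ 2^M · n).
InA : ℕ → ℕ → ℕ → ℕ × ℕ → Set
InA a b n (p Data.Product., q) =
  Coprime p q × (3 ^ (n Data.Nat.∸ 1) < q) × (q ≤ 3 ^ n)
  × (∃ λ ε → CantorExpansion p q ε × (∃ λ P → IsPeriod ε P × (b * 2 ^ P ≤ a * n)))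

{-# OPTIONS --safe #-}
-- If (ε_i)_{i>ℓ} is P-periodic but (ε_i)_{i>ℓ-1} is not, then ε_ℓ ≠ ε_(ℓ+P) while the tails
-- after positions ℓ and ℓ + P have equal value; comparing the partial sums up to ℓ and ℓ + P
-- mod 3 then shows 3^ℓ ∣ q. Hence q ≤ 3^n bounds the preperiod by n, and the first n + P digits
-- determine the expansion and so p/q. Read as bits behind a leading 1 they give an injective
-- code below 2^(n+P+1) ≤ 2·2^n·(a/b)·n, as 2^P ≤ 2^M·n with 2^M = a/b.
module Submission where

open import Defs
open import Data.Nat
open import Data.Nat.Properties
open import Data.Nat.DivMod using (_%_; _/_; [m+kn]%n≡m%n; m<n⇒m%n≡m; m*n/n≡m; m/n*n≤m; /-monoˡ-≤)
open import Data.Nat.Divisibility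
  using (_∣_; divides; 1∣_; ∣⇒≤; ∣-antisym; ∣-trans; n∣m*n; m∣m*n; n∣m*n*o; *-monoʳ-∣; *-cancelˡ-∣)
open import Data.Nat.Coprimality as Coprimality using (Coprime; coprime-divisor)
open import Data.Nat.Primality using (Prime; prime?; euclidsLemma; prime⇒nonZero)
open import Data.Nat.Induction using (<-rec)
open import Data.Nat.Tactic.RingSolver using (solve-∀)
open import Data.Product using (_×_; _,_; proj₁; proj₂; uncurry)
open import Data.Sum using (_⊎_; inj₁; inj₂)
open import Data.Empty using (⊥-elim)
open import Data.List using (List; _∷_; length; lookup)
open import Data.List.Membership.Propositional.Properties using (∈-lookup)
open import Data.List.Relation.Unary.All as All using (All)
open import Data.List.Relation.Unary.AllPairs using (_∷_)
open import Data.List.Relation.Unary.Unique.Propositional using (Unique)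
open import Data.Fin using (Fin; fromℕ<) renaming (zero to fzero; suc to fsuc)
open import Data.Fin.Properties using (injective⇒≤; fromℕ<-injective)
open import Function using (_∘_)
open import Relation.Nullary using (¬_; yes; no)
open import Relation.Nullary.Decidable using (toWitness)
open import Relation.Binary.PropositionalEquality
open import Relation.Binary.Definitions using (tri<; tri≈; tri>)

n<3^n : ∀ n → n < 3 ^ n
n<3^n zero = s≤s z≤n
n<3^n (suc n) = begin-strict
    suc n                   ≤⟨ n<3^n n ⟩
    3 ^ n                   <⟨ m<m+n (3 ^ n) (m^n>0 3 n) ⟩
    3 ^ n + 3 ^ n           ≤⟨ m≤n+m (3 ^ n + 3 ^ n) (3 ^ n) ⟩
    3 ^ n + (3 ^ n + 3 ^ n) ≡⟨ cong (λ t → 3 ^ n + (3 ^ n + t)) (+-identityʳ (3 ^ n)) ⟨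
    3 * 3 ^ n               ∎
  where open ≤-Reasoning

short-interval-gap : ∀ {T Q D x y} → x < y → D * Q ≤ x * T → y * T ≤ (D + 1) * Q → T ≤ Q
short-interval-gap {T} {Q} {D} {x} {y} x<y lower upper = +-cancelʳ-≤ (x * T) T Q (begin
    T + x * T   ≤⟨ *-monoˡ-≤ T x<y ⟩
    y * T       ≤⟨ upper ⟩
    (D + 1) * Q ≡⟨ distrib D Q ⟩
    Q + D * Q   ≤⟨ +-monoʳ-≤ Q lower ⟩
    Q + x * T   ∎)
  where
  open ≤-Reasoning
  distrib : ∀ D Q → (D + 1) * Q ≡ Q + D * Q
  distrib = solve-∀

≡-in-short-interval : ∀ {T Q D x y} → Q < T →
  D * Q ≤ x * T → x * T ≤ (D + 1) * Q → D * Q ≤ y * T → y * T ≤ (D + 1) * Q → x ≡ y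
≡-in-short-interval {T} {Q} {D} {x} {y} Q<T x-lower x-upper y-lower y-upper with <-cmp x y
... | tri≈ _ x≡y _ = x≡y
... | tri< x<y _ _ = ⊥-elim (<⇒≱ Q<T (short-interval-gap {T} {Q} {D} x<y x-lower y-upper))
... | tri> _ _ y<x = ⊥-elim (<⇒≱ Q<T (short-interval-gap {T} {Q} {D} y<x y-lower x-upper))

shift : ℕ → (ℕ → ℕ) → ℕ → ℕ
shift k ε i = ε (k + i)

partial-cong : ∀ {ε ε'} → ε ≗ ε' → ∀ k → partial ε k ≡ partial ε' k
partial-cong eq zero = refl
partial-cong eq (suc k) = cong₂ (λ x d → 3 * x + d) (partial-cong eq k) (eq k)

partial-+ : ∀ ε k m → partial ε (k + m) ≡ 3 ^ m * partial ε k + partial (shift k ε) m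
partial-+ ε k zero rewrite +-identityʳ k = sym (trans (+-identityʳ _) (*-identityˡ _))
partial-+ ε k (suc m) rewrite +-suc k m | partial-+ ε k m =
  regroup (3 ^ m) (partial ε k) (partial (shift k ε) m) (ε (k + m))
  where
  regroup : ∀ t x y d → 3 * (t * x + y) + d ≡ 3 * t * x + (3 * y + d)
  regroup = solve-∀

partial-suc-%3 : ∀ ε k → ε k < 3 → partial ε (suc k) % 3 ≡ ε k
partial-suc-%3 ε k εk<3 = begin
    (3 * partial ε k + ε k) % 3 ≡⟨ cong (_% 3) (swap (partial ε k) (ε k)) ⟩
    (ε k + partial ε k * 3) % 3 ≡⟨ [m+kn]%n≡m%n (ε k) (partial ε k) 3 ⟩
    ε k % 3                     ≡⟨ m<n⇒m%n≡m εk<3 ⟩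
    ε k                         ∎
  where
  open ≡-Reasoning
  swap : ∀ x d → 3 * x + d ≡ d + x * 3
  swap = solve-∀

Expansion-*ʳ : ∀ {p q ε} m → Expansion p q ε → Expansion (p * m) (q * m) ε
Expansion-*ʳ {p} {q} {ε} m ex k =
  subst₂ _≤_ (reassoc (partial ε k) q m) (swap p (3 ^ k) m) (*-monoˡ-≤ m (proj₁ (ex k))) ,
  subst₂ _≤_ (swap p (3 ^ k) m) (reassoc (partial ε k + 1) q m) (*-monoˡ-≤ m (proj₂ (ex k)))
  where
  reassoc : ∀ d q m → d * q * m ≡ d * (q * m)
  reassoc = solve-∀
  swap : ∀ p t m → p * t * m ≡ p * m * t
  swap = solve-∀

Expansion-numerator-unique : ∀ {x y Q ε ε'} → Expansion x Q ε → Expansion y Q ε' → ε ≗ ε' → x ≡ y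
Expansion-numerator-unique {Q = Q} {ε} {ε'} ex ey eq =
  ≡-in-short-interval {3 ^ Q} {Q} {partial ε Q} (n<3^n Q) (proj₁ (ex Q)) (proj₂ (ex Q))
    (subst (λ d → d * Q ≤ _) same-prefix (proj₁ (ey Q)))
    (subst (λ d → _ ≤ (d + 1) * Q) same-prefix (proj₂ (ey Q)))
  where
  same-prefix : partial ε' Q ≡ partial ε Q
  same-prefix = sym (partial-cong eq Q)

Expansion-ratio-unique : ∀ {p q p' q' ε ε'} → Expansion p q ε → Expansion p' q' ε' → ε ≗ ε' →
  p * q' ≡ p' * q
Expansion-ratio-unique {p} {q} {p'} {q'} {ε' = ε'} ex ex' =
  Expansion-numerator-unique (Expansion-*ʳ {p} q' ex)
    (subst (λ d → Expansion (p' * q) d ε') (*-comm q' q) (Expansion-*ʳ {p'} {q'} q ex'))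

-- q times the value 3^k·p/q − partial_k of the digits after the k-th.
remainder : ℕ → ℕ → (ℕ → ℕ) → ℕ → ℕ
remainder p q ε k = p * 3 ^ k ∸ partial ε k * q

remainder+partial : ∀ {p q ε} → Expansion p q ε → ∀ k → remainder p q ε k + partial ε k * q ≡ p * 3 ^ k
remainder+partial ex k = m∸n+n≡m (proj₁ (ex k))

Expansion-shift : ∀ {p q ε} k → Expansion p q ε → Expansion (remainder p q ε k) q (shift k ε)
Expansion-shift {p} {q} {ε} k ex m = lower , upper
  where
  open ≤-Reasoning
  S = partial (shift k ε) m
  A = partial ε k * q * 3 ^ m
  N = p * 3 ^ k * 3 ^ m
  below = proj₁ (ex (k + m))
  above = proj₂ (ex (k + m))
  value : p * 3 ^ (k + m) ≡ N
  value = trans (cong (p *_) (^-distribˡ-+-* 3 k m)) (sym (*-assoc p _ _))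
  split-lower : partial ε (k + m) * q ≡ S * q + A
  split-lower = trans (cong (_* q) (partial-+ ε k m)) (ring (3 ^ m) (partial ε k) S q)
    where
    ring : ∀ t x s q → (t * x + s) * q ≡ s * q + x * q * t
    ring = solve-∀
  split-upper : (partial ε (k + m) + 1) * q ≡ A + (S + 1) * q
  split-upper = trans (cong (λ d → (d + 1) * q) (partial-+ ε k m)) (ring (3 ^ m) (partial ε k) S q)
    where
    ring : ∀ t x s q → (t * x + s + 1) * q ≡ x * q * t + (s + 1) * q
    ring = solve-∀
  lower : S * q ≤ remainder p q ε k * 3 ^ m
  lower = begin
    S * q                       ≤⟨ m+n≤o⇒m≤o∸n (S * q) (subst₂ _≤_ split-lower value below) ⟩
    N ∸ A                       ≡⟨ *-distribʳ-∸ (3 ^ m) (p * 3 ^ k) (partial ε k * q) ⟨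
    remainder p q ε k * 3 ^ m   ∎
  upper : remainder p q ε k * 3 ^ m ≤ (S + 1) * q
  upper = begin
    remainder p q ε k * 3 ^ m   ≡⟨ *-distribʳ-∸ (3 ^ m) (p * 3 ^ k) (partial ε k * q) ⟩
    N ∸ A                       ≤⟨ m≤n+o⇒m∸n≤o N A (subst₂ _≤_ value split-upper above) ⟩
    (S + 1) * q                 ∎

remainder-≗ : ∀ {p q ε} k k' → Expansion p q ε → shift k ε ≗ shift k' ε →
  remainder p q ε k ≡ remainder p q ε k'
remainder-≗ {p} k k' ex = Expansion-numerator-unique (Expansion-shift {p} k ex) (Expansion-shift {p} k' ex)

remainder+partial-periodic : ∀ {p q ε} k P → Expansion p q ε → shift (k + P) ε ≗ shift k ε →
  remainder p q ε k + partial ε (k + P) * q ≡ p * 3 ^ k * 3 ^ P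
remainder+partial-periodic {p} {q} {ε} k P ex periodic = begin
    remainder p q ε k + partial ε (k + P) * q       ≡⟨ cong (_+ partial ε (k + P) * q) same-remainder ⟨
    remainder p q ε (k + P) + partial ε (k + P) * q ≡⟨ remainder+partial {p} ex (k + P) ⟩
    p * 3 ^ (k + P)                                 ≡⟨ cong (p *_) (^-distribˡ-+-* 3 k P) ⟩
    p * (3 ^ k * 3 ^ P)                             ≡⟨ *-assoc p _ _ ⟨
    p * 3 ^ k * 3 ^ P                               ∎
  where
  open ≡-Reasoning
  same-remainder : remainder p q ε (k + P) ≡ remainder p q ε k
  same-remainder = remainder-≗ {p} (k + P) k ex periodic

∣∸⇒%≡ : ∀ {m n} d .{{_ : NonZero d}} → n ≤ m → d ∣ m ∸ n → m % d ≡ n % d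
∣∸⇒%≡ {m} {n} d n≤m (divides c m∸n≡c*d) = begin
    m % d             ≡⟨ cong (_% d) (m+[n∸m]≡n n≤m) ⟨
    (n + (m ∸ n)) % d ≡⟨ cong (λ t → (n + t) % d) m∸n≡c*d ⟩
    (n + c * d) % d   ≡⟨ [m+kn]%n≡m%n n c d ⟩
    n % d             ∎
  where open ≡-Reasoning

prime^∣-cancelˡ : ∀ {p d} k q → Prime p → ¬ p ∣ d → p ^ k ∣ d * q → p ^ k ∣ q
prime^∣-cancelˡ zero q _ _ _ = 1∣ q
prime^∣-cancelˡ {p} {d} (suc k) q pp p∤d p^k+1∣dq
  with euclidsLemma d q pp (∣-trans (m∣m*n (p ^ k)) p^k+1∣dq)
... | inj₁ p∣d = ⊥-elim (p∤d p∣d)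
... | inj₂ (divides q′ refl) =
  subst (p * p ^ k ∣_) (*-comm p q′) (*-monoʳ-∣ p (prime^∣-cancelˡ k q′ pp p∤d p^k∣dq′))
  where
  instance _ = prime⇒nonZero pp
  regroup : ∀ d q′ p → d * (q′ * p) ≡ p * (d * q′)
  regroup = solve-∀
  p^k∣dq′ : p ^ k ∣ d * q′
  p^k∣dq′ = *-cancelˡ-∣ p (subst (p * p ^ k ∣_) (regroup d q′ p) p^k+1∣dq)

prime-3 : Prime 3
prime-3 = toWitness {a? = prime? 3} _

Cantor-digit<3 : ∀ {d} → (d ≡ 0) ⊎ (d ≡ 2) → d < 3
Cantor-digit<3 (inj₁ refl) = s≤s z≤n
Cantor-digit<3 (inj₂ refl) = s≤s (s≤s (s≤s z≤n))

-- (B ∸ A)·q = p·3^(j+1)·(3^P ∸ 1), while B and A differ mod 3 because their last digits differ.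
digit-mismatch⇒3^∣q : ∀ {p q ε} j P .{{_ : NonZero q}} → CantorDigits ε → Expansion p q ε →
  shift (suc j + P) ε ≗ shift (suc j) ε → ε (j + P) ≢ ε j → 3 ^ suc j ∣ q
digit-mismatch⇒3^∣q {p} {q} {ε} j P digits ex periodic mismatch =
  prime^∣-cancelˡ (suc j) q prime-3 (mismatch ∘ digits-agree)
    (subst (M ∣_) (sym difference) (n∣m*n*o p (3 ^ P ∸ 1)))
  where
  open ≡-Reasoning
  M = 3 ^ suc j
  A = partial ε (suc j)
  B = partial ε (suc j + P)
  r = remainder p q ε (suc j)
  below : r + A * q ≡ p * M
  below = remainder+partial {p} {q} {ε} ex (suc j)
  above : r + B * q ≡ p * M * 3 ^ P
  above = remainder+partial-periodic {p} {q} {ε} (suc j) P ex periodic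
  A≤B : A ≤ B
  A≤B = *-cancelʳ-≤ A B q (+-cancelˡ-≤ r _ _
          (subst₂ _≤_ (sym below) (sym above) (m≤m*n (p * M) (3 ^ P) {{m^n≢0 3 P}})))
  difference : (B ∸ A) * q ≡ p * M * (3 ^ P ∸ 1)
  difference = begin
    (B ∸ A) * q               ≡⟨ *-distribʳ-∸ q B A ⟩
    B * q ∸ A * q             ≡⟨ [m+n]∸[m+o]≡n∸o r (B * q) (A * q) ⟨
    (r + B * q) ∸ (r + A * q) ≡⟨ cong₂ _∸_ above below ⟩
    p * M * 3 ^ P ∸ p * M     ≡⟨ cong (p * M * 3 ^ P ∸_) (*-identityʳ (p * M)) ⟨
    p * M * 3 ^ P ∸ p * M * 1 ≡⟨ *-distribˡ-∸ (p * M) (3 ^ P) 1 ⟨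
    p * M * (3 ^ P ∸ 1)       ∎
  digits-agree : 3 ∣ B ∸ A → ε (j + P) ≡ ε j
  digits-agree 3∣B∸A = begin
    ε (j + P) ≡⟨ partial-suc-%3 ε (j + P) (Cantor-digit<3 (digits (j + P))) ⟨
    B % 3     ≡⟨ ∣∸⇒%≡ 3 A≤B 3∣B∸A ⟩
    A % 3     ≡⟨ partial-suc-%3 ε j (Cantor-digit<3 (digits j)) ⟩
    ε j       ∎

periodic-extends-back : ∀ {ε j P} → PurelyPeriodicFrom ε (suc j) P → ε (j + P) ≡ ε j →
  PurelyPeriodicFrom ε j P
periodic-extends-back {ε} {j} {P} (1≤P , periodic) εj+P≡εj = 1≤P , periodic′
  where
  periodic′ : ∀ i → ε (j + P + i) ≡ ε (j + i)
  periodic′ zero = trans (cong ε (+-identityʳ (j + P))) (trans εj+P≡εj (cong ε (sym (+-identityʳ j))))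
  periodic′ (suc i) =
    trans (cong ε (+-suc (j + P) i)) (trans (periodic i) (cong ε (sym (+-suc j i))))

PurelyPeriodicFrom-≤ : ∀ {ε ℓ m P} → ℓ ≤ m → PurelyPeriodicFrom ε ℓ P → PurelyPeriodicFrom ε m P
PurelyPeriodicFrom-≤ {ε} {ℓ} {m} {P} ℓ≤m (1≤P , periodic) with m≤n⇒∃[o]m+o≡n ℓ≤m
... | d , refl = 1≤P , λ i →
  trans (cong ε (reorder ℓ d P i)) (trans (periodic (d + i)) (cong ε (sym (+-assoc ℓ d i))))
  where
  reorder : ∀ ℓ d P i → ℓ + d + P + i ≡ ℓ + P + (d + i)
  reorder = solve-∀

preperiod≤ : ∀ {p q n ε ℓ} .{{_ : NonZero q}} → q ≤ 3 ^ n → CantorDigits ε → Expansion p q ε →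
  IsPreperiod ε ℓ → ℓ ≤ n
preperiod≤ {ℓ = zero} _ _ _ _ = z≤n
preperiod≤ {p} {q} {n} {ε} {suc j} q≤3^n digits ex ((P , periodic) , minimal) =
  ≮⇒≥ λ n<1+j → <⇒≱ (^-monoʳ-< 3 (s≤s (s≤s z≤n)) n<1+j) (≤-trans (∣⇒≤ 3^[1+j]∣q) q≤3^n)
  where
  mismatch : ε (j + P) ≢ ε j
  mismatch eq = minimal j (n<1+n j) (P , periodic-extends-back {ε} {j} {P} periodic eq)
  3^[1+j]∣q : 3 ^ suc j ∣ q
  3^[1+j]∣q = digit-mismatch⇒3^∣q {p} j P digits ex (proj₂ periodic) mismatch

IsPeriod⇒PurelyPeriodicFrom : ∀ {p q n ε P} .{{_ : NonZero q}} → q ≤ 3 ^ n → CantorExpansion p q ε →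
  IsPeriod ε P → PurelyPeriodicFrom ε n P
IsPeriod⇒PurelyPeriodicFrom {p} {q} {n} {ε} {P} q≤3^n (digits , ex) (ℓ , preperiod , periodic , _) =
  PurelyPeriodicFrom-≤ {ε} {ℓ} {n} {P} (preperiod≤ {p} q≤3^n digits ex preperiod) periodic

periodic-≗ : ∀ {ε ε' m P} → PurelyPeriodicFrom ε m P → PurelyPeriodicFrom ε' m P →
  (∀ i → i < m + P → ε i ≡ ε' i) → ε ≗ ε'
periodic-≗ {ε} {ε'} {m} {P} (1≤P , periodic) (_ , periodic') prefix = <-rec (λ i → ε i ≡ ε' i) agree
  where
  agree : ∀ i → (∀ {j} → j < i → ε j ≡ ε' j) → ε i ≡ ε' i
  agree i earlier with i <? m + P
  ... | yes i<m+P = prefix i i<m+P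
  ... | no i≮m+P with m≤n⇒∃[o]m+o≡n (≮⇒≥ i≮m+P)
  ...   | t , refl = trans (periodic t) (trans (earlier (+-monoˡ-< t (m<m+n m 1≤P))) (sym (periodic' t)))

lowest-terms-unique : ∀ {p q p' q'} .{{_ : NonZero q}} → Coprime p q → Coprime p' q' →
  p * q' ≡ p' * q → p ≡ p' × q ≡ q'
lowest-terms-unique {p} {q} {p'} {q'} coprime coprime' cross = p≡p' , q≡q'
  where
  q≡q' : q ≡ q'
  q≡q' = ∣-antisym
    (coprime-divisor (Coprimality.sym coprime) (subst (q ∣_) (sym cross) (n∣m*n p')))
    (coprime-divisor (Coprimality.sym coprime') (subst (q' ∣_) cross (n∣m*n p)))
  p≡p' : p ≡ p'
  p≡p' = *-cancelʳ-≡ p p' q (subst (λ d → p * d ≡ p' * q) (sym q≡q') cross)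

bit : ℕ → ℕ
bit zero = 0
bit (suc _) = 1

bit<2 : ∀ d → bit d < 2
bit<2 zero = s≤s z≤n
bit<2 (suc _) = s≤s (s≤s z≤n)

Cantor-bit-injective : ∀ {d d'} → (d ≡ 0) ⊎ (d ≡ 2) → (d' ≡ 0) ⊎ (d' ≡ 2) → bit d ≡ bit d' → d ≡ d'
Cantor-bit-injective (inj₁ refl) (inj₁ refl) _ = refl
Cantor-bit-injective (inj₂ refl) (inj₂ refl) _ = refl
Cantor-bit-injective (inj₁ refl) (inj₂ refl) ()
Cantor-bit-injective (inj₂ refl) (inj₁ refl) ()

-- The leading 1 makes the length k recoverable from the code.
binaryCode : (ℕ → ℕ) → ℕ → ℕ
binaryCode ε zero = 1
binaryCode ε (suc k) = 2 * binaryCode ε k + bit (ε k)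

binaryCode-≥ : ∀ ε k → 2 ^ k ≤ binaryCode ε k
binaryCode-≥ ε zero = ≤-refl
binaryCode-≥ ε (suc k) = ≤-trans (*-monoʳ-≤ 2 (binaryCode-≥ ε k)) (m≤m+n _ _)

binaryCode-< : ∀ ε k → binaryCode ε k < 2 ^ suc k
binaryCode-< ε zero = s≤s (s≤s z≤n)
binaryCode-< ε (suc k) = begin-strict
    2 * binaryCode ε k + bit (ε k) <⟨ +-monoʳ-< (2 * binaryCode ε k) (bit<2 (ε k)) ⟩
    2 * binaryCode ε k + 2         ≡⟨ +-comm (2 * binaryCode ε k) 2 ⟩
    2 + 2 * binaryCode ε k         ≡⟨ *-suc 2 (binaryCode ε k) ⟨
    2 * suc (binaryCode ε k)       ≤⟨ *-monoʳ-≤ 2 (binaryCode-< ε k) ⟩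
    2 * 2 ^ suc k                  ∎
  where open ≤-Reasoning

binaryCode-<-shorter : ∀ ε ε' {k k'} → k < k' → binaryCode ε k < binaryCode ε' k'
binaryCode-<-shorter ε ε' {k} {k'} k<k' =
  <-≤-trans (binaryCode-< ε k) (≤-trans (^-monoʳ-≤ 2 k<k') (binaryCode-≥ ε' k'))

binaryCode-length : ∀ ε ε' {k k'} → binaryCode ε k ≡ binaryCode ε' k' → k ≡ k'
binaryCode-length ε ε' {k} {k'} eq with <-cmp k k'
... | tri≈ _ k≡k' _ = k≡k'
... | tri< k<k' _ _ = ⊥-elim (<⇒≢ (binaryCode-<-shorter ε ε' k<k') eq)
... | tri> _ _ k'<k = ⊥-elim (<⇒≢ (binaryCode-<-shorter ε' ε k'<k) (sym eq))

2*+bit-injective : ∀ {x y a b} → a < 2 → b < 2 → 2 * x + a ≡ 2 * y + b → x ≡ y × a ≡ b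
2*+bit-injective {x} {y} {a} {b} a<2 b<2 eq = x≡y , a≡b
  where
  low : ∀ {x a} → a < 2 → (2 * x + a) % 2 ≡ a
  low {x} {a} a<2 =
    trans (cong (_% 2) (trans (+-comm (2 * x) a) (cong (a +_) (*-comm 2 x))))
          (trans ([m+kn]%n≡m%n a x 2) (m<n⇒m%n≡m a<2))
  a≡b : a ≡ b
  a≡b = trans (sym (low {x} a<2)) (trans (cong (_% 2) eq) (low {y} b<2))
  x≡y : x ≡ y
  x≡y = *-cancelˡ-≡ x y 2 (+-cancelʳ-≡ a (2 * x) (2 * y) (trans eq (cong (2 * y +_) (sym a≡b))))

binaryCode-bits : ∀ ε ε' {k} → binaryCode ε k ≡ binaryCode ε' k → ∀ i → i < k → bit (ε i) ≡ bit (ε' i)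
binaryCode-bits ε ε' {suc k} eq i i<1+k
  with 2*+bit-injective (bit<2 (ε k)) (bit<2 (ε' k)) eq
... | prefix-eq , last-eq with m≤n⇒m<n∨m≡n (s≤s⁻¹ i<1+k)
...   | inj₁ i<k = binaryCode-bits ε ε' prefix-eq i i<k
...   | inj₂ refl = last-eq

*≤⇒≤/ : ∀ {b c T} .{{_ : NonZero b}} → b * c ≤ T → c ≤ T / b
*≤⇒≤/ {b} {c} {T} b*c≤T =
  subst (_≤ T / b) (m*n/n≡m c b) (/-monoˡ-≤ b (subst (_≤ T) (*-comm b c) b*c≤T))

*[/]≤ : ∀ b T .{{_ : NonZero b}} → b * (T / b) ≤ T
*[/]≤ b T = subst (_≤ T) (*-comm (T / b) b) (m/n*n≤m T b)

Unique⇒lookup-injective : ∀ {A : Set} {xs : List A} → Unique xs →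
  ∀ i j → lookup xs i ≡ lookup xs j → i ≡ j
Unique⇒lookup-injective (_ ∷ _) fzero fzero _ = refl
Unique⇒lookup-injective {xs = _ ∷ xs} (x∉ ∷ _) fzero (fsuc j) eq =
  ⊥-elim (All.lookup x∉ (∈-lookup {xs = xs} j) eq)
Unique⇒lookup-injective {xs = _ ∷ xs} (x∉ ∷ _) (fsuc i) fzero eq =
  ⊥-elim (All.lookup x∉ (∈-lookup {xs = xs} i) (sym eq))
Unique⇒lookup-injective (_ ∷ unique) (fsuc i) (fsuc j) eq =
  cong fsuc (Unique⇒lookup-injective unique i j eq)

Unique⇒length≤ : ∀ {A : Set} {Q : A → Set} {xs : List A} N → Unique xs → All Q xs →
  (code : ∀ {x} → Q x → ℕ) → (∀ {x} (w : Q x) → code w < N) →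
  (∀ {x y} (w : Q x) (w' : Q y) → code w ≡ code w' → x ≡ y) → length xs ≤ N
Unique⇒length≤ {Q = Q} {xs} N unique members code code<N code-injective = injective⇒≤ f-injective
  where
  witness : (i : Fin (length xs)) → Q (lookup xs i)
  witness i = All.lookup members (∈-lookup {xs = xs} i)
  f : Fin (length xs) → Fin N
  f i = fromℕ< (code<N (witness i))
  f-injective : ∀ {i j} → f i ≡ f j → i ≡ j
  f-injective {i} {j} eq = Unique⇒lookup-injective unique i j
    (code-injective (witness i) (witness j)
      (fromℕ<-injective _ _ (code<N (witness i)) (code<N (witness j)) eq))

module Encoding (a b n : ℕ) where

  code : ∀ {x} → InA a b n x → ℕ
  code {_ , _} (_ , _ , _ , ε , _ , P , _) = binaryCode ε (n + P)

  code-injective : ∀ {x y} (w : InA a b n x) (w' : InA a b n y) → code w ≡ code w' → x ≡ y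
  code-injective {p , q} {p' , q'}
    (coprime , q>3^n-1 , q≤3^n , ε , expansion , P , period , _)
    (coprime' , q'>3^n-1 , q'≤3^n , ε' , expansion' , P' , period' , _) eq
    with +-cancelˡ-≡ n P P' (binaryCode-length ε ε' eq)
  ... | refl = uncurry (cong₂ _,_) (lowest-terms-unique coprime coprime' same-ratio)
    where
    instance
      _ = >-nonZero (≤-trans (s≤s z≤n) q>3^n-1)
      _ = >-nonZero (≤-trans (s≤s z≤n) q'>3^n-1)
    same-digits : ε ≗ ε'
    same-digits = periodic-≗ {ε} {ε'} {n} {P}
      (IsPeriod⇒PurelyPeriodicFrom {p} q≤3^n expansion period)
      (IsPeriod⇒PurelyPeriodicFrom {p'} q'≤3^n expansion' period')
      (λ i i<n+P → Cantor-bit-injective (proj₁ expansion i) (proj₁ expansion' i)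
                     (binaryCode-bits ε ε' eq i i<n+P))
    same-ratio : p * q' ≡ p' * q
    same-ratio = Expansion-ratio-unique {p} {q} {p'} (proj₂ expansion) (proj₂ expansion') same-digits

  b*code< : ∀ {x} .{{_ : NonZero b}} (w : InA a b n x) → b * code w < 2 * 2 ^ n * (a * n)
  b*code< {_ , _} (_ , _ , _ , ε , _ , P , _ , b*2^P≤a*n) = begin-strict
    b * binaryCode ε (n + P)   <⟨ *-monoʳ-< b (binaryCode-< ε (n + P)) ⟩
    b * (2 * 2 ^ (n + P))      ≡⟨ cong (λ t → b * (2 * t)) (^-distribˡ-+-* 2 n P) ⟩
    b * (2 * (2 ^ n * 2 ^ P))  ≡⟨ regroup b (2 ^ n) (2 ^ P) ⟩
    2 * 2 ^ n * (b * 2 ^ P)    ≤⟨ *-monoʳ-≤ (2 * 2 ^ n) b*2^P≤a*n ⟩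
    2 * 2 ^ n * (a * n)        ∎
    where
    open ≤-Reasoning
    regroup : ∀ b x y → b * (2 * (x * y)) ≡ 2 * x * (b * y)
    regroup = solve-∀

corollary6p4 : (a b n : ℕ) → 1 ≤ b → b < a → 1 ≤ n →
    (xs : List (ℕ × ℕ)) → Unique xs → All (InA a b n) xs →
    b * length xs ≤ 4 * a * n * 2 ^ n
corollary6p4 a b n 1≤b b<a 1≤n xs unique members = begin
    b * length xs     ≤⟨ *-monoʳ-≤ b (Unique⇒length≤ (suc (T / b)) unique members
                                         code code<1+T/b code-injective) ⟩
    b * suc (T / b)   ≡⟨ *-suc b (T / b) ⟩
    b + b * (T / b)   ≤⟨ +-mono-≤ b≤T (*[/]≤ b T) ⟩
    T + T             ≡⟨ double a n (2 ^ n) ⟩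
    4 * a * n * 2 ^ n ∎
  where
  open ≤-Reasoning
  open Encoding a b n
  instance _ = >-nonZero 1≤b
  T = 2 * 2 ^ n * (a * n)
  code<1+T/b : ∀ {x} (w : InA a b n x) → code w < suc (T / b)
  code<1+T/b w = s≤s (*≤⇒≤/ (<⇒≤ (b*code< w)))
  b≤T : b ≤ T
  b≤T = ≤-trans (<⇒≤ b<a)
          (≤-trans (m≤m*n a n {{>-nonZero 1≤n}}) (m≤n*m (a * n) (2 * 2 ^ n) {{m^n≢0 2 (suc n)}}))
  double : ∀ a n x → 2 * x * (a * n) + 2 * x * (a * n) ≡ 4 * a * n * x
  double = solve-∀
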